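{- Let $n$ be even and $T$ the normalized indicator function of the half slice in $\{0,1\}^n$. Then: (1) if $\frac n3\leq |x|\leq\frac{2n}{3}$, then $(T\ast T)(x)<4$; (2) $\|(T\ast T)^2\|_2=O(1)$.
   Context: $|x|$ is Hamming weight; $T(x)=\tau^{ -1}\mathbf{1}[|x|=n/2]$ with $\tau=2^{ -n}\binom{n}{n/2}$. $(a\ast b)(x)=\mathbb{E}_{y\sim\{0,1\}^n}[a(y)b(x+y)]$ with $y$ uniform and addition mod $2$; $\|a\|_2=(\mathbb{E}_x[a(x)^2])^{1/2}$ with $x$ uniform. The $O(1)$ is an absolute constant independent of $n$. -}

module Defs where

open import Data.Bool using (Bool; true; false; _xor_; if_then_else_)
open import Data.Nat as ℕ using (ℕ; zero; suc; _≡ᵇ_)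
open import Data.Nat.Combinatorics using (_C_)
open import Data.Integer using (+_)
open import Data.Rational using (ℚ; 0ℚ; 1ℚ; _/_; _+_; _*_)
open import Data.List using (List; []; _∷_; map; _++_; foldr)
open import Data.Vec using (Vec; []; _∷_; zipWith; count)
open import Relation.Nullary.Decidable using (Dec; yes; no)
open import Relation.Binary.PropositionalEquality using (_≡_)

-- The Boolean cube {0,1}^n, with true = 1.
Cube : ℕ → Set
Cube n = Vec Bool n

allPts : (n : ℕ) → List (Cube n)
allPts zero    = [] ∷ []
allPts (suc n) = map (false ∷_) (allPts n) ++ map (true ∷_) (allPts n)

isOne : (b : Bool) → Dec (b ≡ true)
isOne true  = yes _≡_.refl
isOne false = no (λ ())

weight : {n : ℕ} → Cube n → ℕ
weight x = count isOne x

_⊕_ : {n : ℕ} → Cube n → Cube n → Cube n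
x ⊕ y = zipWith _xor_ x y

natℚ : ℕ → ℚ
natℚ k = + k / 1

-- Reciprocal of a natural number as a rational (0 ↦ 0 by convention;
-- only ever applied to strictly positive numbers below).
recip : ℕ → ℚ
recip zero    = 0ℚ
recip (suc k) = + 1 / suc k

sumℚ : List ℚ → ℚ
sumℚ = foldr _+_ 0ℚ

𝔼 : (n : ℕ) → (Cube n → ℚ) → ℚ
𝔼 n f = sumℚ (map f (allPts n)) * recip (2 ℕ.^ n)

τ : ℕ → ℚ
τ n = natℚ (n C (n ℕ./ 2)) * recip (2 ℕ.^ n)

τ⁻¹ : ℕ → ℚ
τ⁻¹ n = natℚ (2 ℕ.^ n) * recip (n C (n ℕ./ 2))

T : (n : ℕ) → Cube n → ℚ
T n x = if weight x ≡ᵇ (n ℕ./ 2) then τ⁻¹ n else 0ℚ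

conv : (n : ℕ) → (Cube n → ℚ) → (Cube n → ℚ) → Cube n → ℚ
conv n a b x = 𝔼 n (λ y → a y * b (x ⊕ y))

TT : (n : ℕ) → Cube n → ℚ
TT n = conv n (T n) (T n)

normSq : (n : ℕ) → (Cube n → ℚ) → ℚ
normSq n f = 𝔼 n (λ x → f x * f x)

module Submission where

-- Write n = 2q. If y and x + y both lie in the middle slice, then y meets the support of x in
-- exactly half of it; hence (T ∗ T)(x) = 0 for odd |x|, and for |x| = 2h, l = q − h,
-- (T ∗ T)(x) = 4^q C(2h,h) C(2l,l) / C(2q,q)². The estimates 16^k ≤ 4k C(2k,k)² and
-- C(2k,k)² (3k + 1) ≤ 16^k give (T ∗ T)(x)² ≤ 16 q² / ((3h + 1)(3l + 1)), which is < 16 when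
-- h, l ≥ q/3, and (T ∗ T)(x)⁴ ≤ 256 + 64 (|x| − (n − |x|))⁴ / q². Averaging the latter against the
-- fourth moment E (|x| − (n − |x|))⁴ = 3n² − 2n of the uniform measure gives ‖(T ∗ T)²‖₂² ≤ 32².

module CentralBinomial where
  open import Data.List using (_∷_; [])
  open import Data.Nat
  open import Data.Nat.Combinatorics using (_C_; nCk≡n!/k![n-k]!; k![n∸k]!∣n!)
  open import Data.Nat.DivMod using (m/n*n≡m)
  open import Data.Nat.Properties
  open import Data.Nat.Tactic.RingSolver using (solve; solve-∀)
  open import Data.Product using (_×_; _,_)
  open import Relation.Binary.PropositionalEquality
  open import Relation.Nullary using (yes; no)

  m*m<n*n⇒m<n : ∀ {m n} → m * m < n * n → m < n
  m*m<n*n⇒m<n lt = ≰⇒> λ n≤m → <⇒≱ lt (*-mono-≤ n≤m n≤m)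

  ^-distribʳ-* : ∀ m n o → (m * n) ^ o ≡ m ^ o * n ^ o
  ^-distribʳ-* m n zero    = refl
  ^-distribʳ-* m n (suc o) =
    trans (cong (m * n *_) (^-distribʳ-* m n o)) ([m*n]*[o*p]≡[m*o]*[n*p] m n (m ^ o) (n ^ o))

  [m+n]*[m+n]≡4*m*n+∣m-n∣*∣m-n∣ : ∀ m n → (m + n) * (m + n) ≡ 4 * m * n + ∣ m - n ∣ * ∣ m - n ∣
  [m+n]*[m+n]≡4*m*n+∣m-n∣*∣m-n∣ zero    n       = refl
  [m+n]*[m+n]≡4*m*n+∣m-n∣*∣m-n∣ (suc m) zero    =
    trans (cong (λ k → k * k) (+-identityʳ (suc m))) (cong (_+ suc m * suc m) (sym (*-zeroʳ (4 * suc m))))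
  -- Here and below, `with` abstracts non-polynomial subterms so that the ring solver sees variables.
  [m+n]*[m+n]≡4*m*n+∣m-n∣*∣m-n∣ (suc m) (suc n)
    with ∣ m - n ∣ | [m+n]*[m+n]≡4*m*n+∣m-n∣*∣m-n∣ m n
  ... | d | ih = begin
    (suc m + suc n) * (suc m + suc n)   ≡⟨ solve (m ∷ n ∷ []) ⟩
    (m + n) * (m + n) + 4 * (m + n + 1) ≡⟨ cong (_+ 4 * (m + n + 1)) ih ⟩
    4 * m * n + d * d + 4 * (m + n + 1) ≡⟨ solve (m ∷ n ∷ d ∷ []) ⟩
    4 * suc m * suc n + d * d           ∎
    where open ≡-Reasoning

  sextic-bound : ∀ {q P a e} → q * q ≡ a + e * e → 2 * a ≤ P → q ≤ P →
    256 * (q * q * (q * q) * (q * q)) ≤ P * P * (256 * (q * q) + 1024 * (e * e * (e * e)))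
  sextic-bound {q} {P} {a} {e} q²≡a+e² 2a≤P q≤P with e * e ≤? a
  ... | yes e²≤a = begin
    256 * (q * q * (q * q) * (q * q))
      ≡⟨ solve (q ∷ []) ⟩
    q * q * (q * q) * (256 * (q * q))
      ≤⟨ *-monoˡ-≤ (256 * (q * q)) (*-mono-≤ q²≤P q²≤P) ⟩
    P * P * (256 * (q * q))
      ≤⟨ *-monoʳ-≤ (P * P) (m≤m+n (256 * (q * q)) _) ⟩
    P * P * (256 * (q * q) + 1024 * (e * e * (e * e)))
      ∎
    where
    open ≤-Reasoning
    q²≤P : q * q ≤ P
    q²≤P = begin
      q * q     ≡⟨ q²≡a+e² ⟩
      a + e * e ≤⟨ +-monoʳ-≤ a e²≤a ⟩
      a + a     ≡⟨ solve (a ∷ []) ⟩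
      2 * a     ≤⟨ 2a≤P ⟩
      P         ∎
  ... | no e²≰a = begin
    256 * (q * q * (q * q) * (q * q))
      ≤⟨ *-monoʳ-≤ 256 (*-mono-≤ q⁴≤4e⁴ (*-mono-≤ q≤P q≤P)) ⟩
    256 * (4 * (e * e * (e * e)) * (P * P))
      ≡⟨ solve (e ∷ P ∷ []) ⟩
    P * P * (1024 * (e * e * (e * e)))
      ≤⟨ *-monoʳ-≤ (P * P) (m≤n+m _ (256 * (q * q))) ⟩
    P * P * (256 * (q * q) + 1024 * (e * e * (e * e)))
      ∎
    where
    open ≤-Reasoning
    q²≤2e² : q * q ≤ 2 * (e * e)
    q²≤2e² = begin
      q * q         ≡⟨ q²≡a+e² ⟩
      a + e * e     ≤⟨ +-monoˡ-≤ (e * e) (<⇒≤ (≰⇒> e²≰a)) ⟩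
      e * e + e * e ≡⟨ solve (e ∷ []) ⟩
      2 * (e * e)   ∎
    q⁴≤4e⁴ : q * q * (q * q) ≤ 4 * (e * e * (e * e))
    q⁴≤4e⁴ = begin
      q * q * (q * q)             ≤⟨ *-mono-≤ q²≤2e² q²≤2e² ⟩
      2 * (e * e) * (2 * (e * e)) ≡⟨ solve (e ∷ []) ⟩
      4 * (e * e * (e * e))       ∎

  nCk*[k!*[n∸k]!]≡n! : ∀ {n k} → k ≤ n → (n C k) * (k ! * (n ∸ k) !) ≡ n !
  nCk*[k!*[n∸k]!]≡n! {n} {k} k≤n = begin
    (n C k) * (k ! * (n ∸ k) !)                 ≡⟨ cong (_* (k ! * (n ∸ k) !)) (nCk≡n!/k![n-k]! k≤n) ⟩
    n ! / (k ! * (n ∸ k) !) * (k ! * (n ∸ k) !) ≡⟨ m/n*n≡m (k![n∸k]!∣n! k≤n) ⟩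
    n !                                         ∎
    where
    open ≡-Reasoning
    instance
      k!*[n∸k]!≢0 : NonZero (k ! * (n ∸ k) !)
      k!*[n∸k]!≢0 = k !* (n ∸ k) !≢0

  nCk≢0 : ∀ {n k} → k ≤ n → NonZero (n C k)
  nCk≢0 {n} {k} k≤n = ≢-nonZero λ nCk≡0 → ≢-nonZero⁻¹ (n !) {{n !≢0}}
    (trans (sym (nCk*[k!*[n∸k]!]≡n! k≤n)) (cong (_* (k ! * (n ∸ k) !)) nCk≡0))

  centralBinomial : ℕ → ℕ
  centralBinomial k = (k * 2) C k

  centralBinomial-nonZero : ∀ k → NonZero (centralBinomial k)
  centralBinomial-nonZero k = nCk≢0 (m≤m*n k 2)

  centralBinomial*factorial² : ∀ k → centralBinomial k * (k ! * k !) ≡ (k * 2) !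
  centralBinomial*factorial² k = begin
    centralBinomial k * (k ! * k !)           ≡⟨ cong (λ m → centralBinomial k * (k ! * m !)) k≡k*2∸k ⟩
    centralBinomial k * (k ! * (k * 2 ∸ k) !) ≡⟨ nCk*[k!*[n∸k]!]≡n! (m≤m*n k 2) ⟩
    (k * 2) !                                 ∎
    where
    open ≡-Reasoning
    k*2≡k+k : k * 2 ≡ k + k
    k*2≡k+k = solve (k ∷ [])
    k≡k*2∸k : k ≡ k * 2 ∸ k
    k≡k*2∸k = sym (trans (cong (_∸ k) k*2≡k+k) (m+n∸m≡n k k))

  centralBinomial-suc : ∀ k → centralBinomial (suc k) * suc k ≡ 2 * (1 + k * 2) * centralBinomial k
  centralBinomial-suc k = *-cancelʳ-≡ _ _ (suc k ! * k !) {{suc k !* k !≢0}} (begin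
    centralBinomial (suc k) * suc k * (suc k ! * k !)
      ≡⟨ regroupˡ (centralBinomial (suc k)) k (k !) ⟩
    centralBinomial (suc k) * (suc k ! * suc k !)
      ≡⟨ centralBinomial*factorial² (suc k) ⟩
    (2 + k * 2) * ((1 + k * 2) * (k * 2) !)
      ≡⟨ cong (λ m → (2 + k * 2) * ((1 + k * 2) * m)) (centralBinomial*factorial² k) ⟨
    (2 + k * 2) * ((1 + k * 2) * (centralBinomial k * (k ! * k !)))
      ≡⟨ regroupʳ k (centralBinomial k) (k !) ⟩
    2 * (1 + k * 2) * centralBinomial k * (suc k ! * k !)
      ∎)
    where
    open ≡-Reasoning
    regroupˡ : ∀ b k f → b * suc k * (suc k * f * f) ≡ b * (suc k * f * (suc k * f))
    regroupˡ = solve-∀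
    regroupʳ : ∀ k b f → (2 + k * 2) * ((1 + k * 2) * (b * (f * f))) ≡ 2 * (1 + k * 2) * b * (suc k * f * f)
    regroupʳ = solve-∀

  centralBinomial²-upper : ∀ k → centralBinomial k * centralBinomial k * (1 + 3 * k) ≤ 16 ^ k
  centralBinomial²-upper zero    = ≤-refl
  centralBinomial²-upper (suc k)
    with centralBinomial k | centralBinomial (suc k) | centralBinomial-suc k | centralBinomial²-upper k
  ... | B | B′ | rec | ih = *-cancelˡ-≤ (suc k * suc k) (begin
    suc k * suc k * (B′ * B′ * (1 + 3 * suc k))
      ≡⟨ solve (k ∷ B′ ∷ []) ⟩
    (B′ * suc k) * (B′ * suc k) * (4 + 3 * k)
      ≡⟨ cong (λ m → m * m * (4 + 3 * k)) rec ⟩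
    (2 * (1 + k * 2) * B) * (2 * (1 + k * 2) * B) * (4 + 3 * k)
      ≡⟨ solve (k ∷ B ∷ []) ⟩
    4 * ((1 + k * 2) * (1 + k * 2)) * (4 + 3 * k) * (B * B)
      ≤⟨ *-monoˡ-≤ (B * B) poly ⟩
    16 * (suc k * suc k) * (1 + 3 * k) * (B * B)
      ≡⟨ solve (k ∷ B ∷ []) ⟩
    suc k * suc k * (16 * (B * B * (1 + 3 * k)))
      ≤⟨ *-monoʳ-≤ (suc k * suc k) (*-monoʳ-≤ 16 ih) ⟩
    suc k * suc k * 16 ^ suc k
      ∎)
    where
    open ≤-Reasoning
    poly : 4 * ((1 + k * 2) * (1 + k * 2)) * (4 + 3 * k) ≤ 16 * (suc k * suc k) * (1 + 3 * k)
    poly = begin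
      4 * ((1 + k * 2) * (1 + k * 2)) * (4 + 3 * k)         ≤⟨ m≤m+n _ (4 * k) ⟩
      4 * ((1 + k * 2) * (1 + k * 2)) * (4 + 3 * k) + 4 * k ≡⟨ solve (k ∷ []) ⟩
      16 * (suc k * suc k) * (1 + 3 * k)                    ∎

  centralBinomial²-lower : ∀ k .{{_ : NonZero k}} → 16 ^ k ≤ 4 * k * (centralBinomial k * centralBinomial k)
  centralBinomial²-lower 1 = ≤-refl
  centralBinomial²-lower (suc (suc k))
    with centralBinomial (suc k) | centralBinomial (2 + k)
       | centralBinomial-suc (suc k) | centralBinomial²-lower (suc k)
  ... | B | B′ | rec | ih = *-cancelˡ-≤ ((2 + k) * (2 + k)) (begin
    (2 + k) * (2 + k) * (16 * 16 ^ suc k)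
      ≤⟨ *-monoʳ-≤ ((2 + k) * (2 + k)) (*-monoʳ-≤ 16 ih) ⟩
    (2 + k) * (2 + k) * (16 * (4 * suc k * (B * B)))
      ≡⟨ solve (k ∷ B ∷ []) ⟩
    16 * (2 + k) * (B * B) * (4 * suc k * (2 + k))
      ≤⟨ *-monoʳ-≤ (16 * (2 + k) * (B * B)) poly ⟩
    16 * (2 + k) * (B * B) * ((3 + k * 2) * (3 + k * 2))
      ≡⟨ solve (k ∷ B ∷ []) ⟩
    4 * (2 + k) * ((2 * (3 + k * 2) * B) * (2 * (3 + k * 2) * B))
      ≡⟨ cong (λ m → 4 * (2 + k) * (m * m)) rec ⟨
    4 * (2 + k) * ((B′ * (2 + k)) * (B′ * (2 + k)))
      ≡⟨ solve (k ∷ B′ ∷ []) ⟩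
    (2 + k) * (2 + k) * (4 * (2 + k) * (B′ * B′))
      ∎)
    where
    open ≤-Reasoning
    poly : 4 * suc k * (2 + k) ≤ (3 + k * 2) * (3 + k * 2)
    poly = begin
      4 * suc k * (2 + k)       ≤⟨ m≤m+n _ 1 ⟩
      4 * suc k * (2 + k) + 1   ≡⟨ solve (k ∷ []) ⟩
      (3 + k * 2) * (3 + k * 2) ∎

  -- C(2q,q)² (T ∗ T)(x) for n = 2q and |x| = 2h, where q = h + l.
  convolutionNumerator : ℕ → ℕ → ℕ
  convolutionNumerator h l = centralBinomial h * centralBinomial l * 4 ^ (h + l)

  convolutionNumerator²-bound : ∀ h l .{{_ : NonZero (h + l)}} →
    let X = convolutionNumerator h l ; B = centralBinomial (h + l) in
    X * X * ((1 + 3 * h) * (1 + 3 * l)) ≤ 16 * ((h + l) * (h + l)) * (B * B * (B * B))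
  convolutionNumerator²-bound h l = begin
    X * X * ((1 + 3 * h) * (1 + 3 * l))
      ≡⟨ regroup Bh Bl (4 ^ (h + l)) (1 + 3 * h) (1 + 3 * l) ⟩
    Bh * Bh * (1 + 3 * h) * (Bl * Bl * (1 + 3 * l)) * (4 ^ (h + l) * 4 ^ (h + l))
      ≡⟨ cong (Bh * Bh * (1 + 3 * h) * (Bl * Bl * (1 + 3 * l)) *_) (^-distribʳ-* 4 4 (h + l)) ⟨
    Bh * Bh * (1 + 3 * h) * (Bl * Bl * (1 + 3 * l)) * 16 ^ (h + l)
      ≤⟨ *-monoˡ-≤ (16 ^ (h + l)) (*-mono-≤ (centralBinomial²-upper h) (centralBinomial²-upper l)) ⟩
    16 ^ h * 16 ^ l * 16 ^ (h + l)
      ≡⟨ cong (_* 16 ^ (h + l)) (^-distribˡ-+-* 16 h l) ⟨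
    16 ^ (h + l) * 16 ^ (h + l)
      ≤⟨ *-mono-≤ (centralBinomial²-lower (h + l)) (centralBinomial²-lower (h + l)) ⟩
    4 * (h + l) * (B * B) * (4 * (h + l) * (B * B))
      ≡⟨ collect (h + l) B ⟩
    16 * ((h + l) * (h + l)) * (B * B * (B * B))
      ∎
    where
    open ≤-Reasoning
    X Bh Bl B : ℕ
    X = convolutionNumerator h l
    Bh = centralBinomial h
    Bl = centralBinomial l
    B = centralBinomial (h + l)
    regroup : ∀ a b f u v → a * b * f * (a * b * f) * (u * v) ≡ a * a * u * (b * b * v) * (f * f)
    regroup = solve-∀
    collect : ∀ q b → 4 * q * (b * b) * (4 * q * (b * b)) ≡ 16 * (q * q) * (b * b * (b * b))
    collect = solve-∀

  convolutionNumerator-< : ∀ h l → h + l ≤ 3 * h → h + l ≤ 3 * l →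
    convolutionNumerator h l < 4 * (centralBinomial (h + l) * centralBinomial (h + l))
  convolutionNumerator-< zero    zero    _  _  = s≤s (s≤s z≤n)
  convolutionNumerator-< zero    (suc l) () _
  convolutionNumerator-< (suc h) l       q≤3h q≤3l =
    square-bound⇒< {q = suc h + l} {X = convolutionNumerator (suc h) l} {B = centralBinomial (suc h + l)}
      {{centralBinomial-nonZero (suc h + l)}}
      (convolutionNumerator²-bound (suc h) l) q²<P
    where
    square-bound⇒< : ∀ {q P X B} .{{_ : NonZero B}} →
      X * X * P ≤ 16 * (q * q) * (B * B * (B * B)) → q * q < P → X < 4 * (B * B)
    square-bound⇒< {q} {P} {X} {B} X²P≤16q²B⁴ q²<P =
      m*m<n*n⇒m<n (*-cancelʳ-< P (X * X) (4 * (B * B) * (4 * (B * B))) (begin-strict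
        X * X * P                        ≤⟨ X²P≤16q²B⁴ ⟩
        16 * (q * q) * (B * B * (B * B)) <⟨ *-monoˡ-< (B * B * (B * B)) (*-monoʳ-< 16 q²<P) ⟩
        16 * P * (B * B * (B * B))       ≡⟨ solve (P ∷ B ∷ []) ⟩
        4 * (B * B) * (4 * (B * B)) * P  ∎))
      where
      open ≤-Reasoning
      instance
        B²≢0 : NonZero (B * B)
        B²≢0 = m*n≢0 B B
        B⁴≢0 : NonZero (B * B * (B * B))
        B⁴≢0 = m*n≢0 (B * B) (B * B)
    q²<P : (suc h + l) * (suc h + l) < (1 + 3 * suc h) * (1 + 3 * l)
    q²<P = begin-strict
      (suc h + l) * (suc h + l)                     ≤⟨ *-mono-≤ q≤3h q≤3l ⟩
      3 * suc h * (3 * l)                           <⟨ m<m+n _ (s≤s z≤n) ⟩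
      3 * suc h * (3 * l) + (1 + 3 * suc h + 3 * l) ≡⟨ solve (h ∷ l ∷ []) ⟩
      (1 + 3 * suc h) * (1 + 3 * l)                 ∎
      where open ≤-Reasoning

  convolutionNumerator⁴-bound : ∀ h l .{{_ : NonZero (h + l)}} →
    let q = h + l ; X = convolutionNumerator h l ; B = centralBinomial (h + l) ; e = ∣ h - l ∣ in
    q * q * (X * X * (X * X))
      ≤ B * B * (B * B) * (B * B * (B * B)) * (256 * (q * q) + 1024 * (e * e * (e * e)))
  convolutionNumerator⁴-bound h l =
    fourth-power-bound {q = h + l} {X = convolutionNumerator h l} {B = centralBinomial (h + l)}
      (convolutionNumerator²-bound h l)
      (sextic-bound {q = h + l} {a = 4 * h * l} {e = ∣ h - l ∣}
        ([m+n]*[m+n]≡4*m*n+∣m-n∣*∣m-n∣ h l) 8hl≤P q≤P)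
    where
    fourth-power-bound : ∀ {q P X B R} .{{_ : NonZero P}} →
      X * X * P ≤ 16 * (q * q) * (B * B * (B * B)) → 256 * (q * q * (q * q) * (q * q)) ≤ P * P * R →
      q * q * (X * X * (X * X)) ≤ B * B * (B * B) * (B * B * (B * B)) * R
    fourth-power-bound {q} {P} {X} {B} {R} X²P≤16q²B⁴ q⁶≤P²R =
      *-cancelʳ-≤ _ _ (P * P) {{m*n≢0 P P}} (begin
        q * q * (X * X * (X * X)) * (P * P)
          ≡⟨ solve (q ∷ P ∷ X ∷ []) ⟩
        q * q * ((X * X * P) * (X * X * P))
          ≤⟨ *-monoʳ-≤ (q * q) (*-mono-≤ X²P≤16q²B⁴ X²P≤16q²B⁴) ⟩
        q * q * (16 * (q * q) * (B * B * (B * B)) * (16 * (q * q) * (B * B * (B * B))))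
          ≡⟨ solve (q ∷ B ∷ []) ⟩
        256 * (q * q * (q * q) * (q * q)) * (B * B * (B * B) * (B * B * (B * B)))
          ≤⟨ *-monoˡ-≤ _ q⁶≤P²R ⟩
        P * P * R * (B * B * (B * B) * (B * B * (B * B)))
          ≡⟨ solve (P ∷ R ∷ B ∷ []) ⟩
        B * B * (B * B) * (B * B * (B * B)) * R * (P * P)
          ∎)
      where open ≤-Reasoning
    8hl≤P : 2 * (4 * h * l) ≤ (1 + 3 * h) * (1 + 3 * l)
    8hl≤P = begin
      2 * (4 * h * l)                               ≤⟨ m≤m+n _ (h * l + 3 * h + 3 * l + 1) ⟩
      2 * (4 * h * l) + (h * l + 3 * h + 3 * l + 1) ≡⟨ solve (h ∷ l ∷ []) ⟩
      (1 + 3 * h) * (1 + 3 * l)                     ∎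
      where open ≤-Reasoning
    q≤P : h + l ≤ (1 + 3 * h) * (1 + 3 * l)
    q≤P = begin
      h + l                                   ≤⟨ m≤m+n _ (9 * h * l + 2 * h + 2 * l + 1) ⟩
      h + l + (9 * h * l + 2 * h + 2 * l + 1) ≡⟨ solve (h ∷ l ∷ []) ⟩
      (1 + 3 * h) * (1 + 3 * l)               ∎
      where open ≤-Reasoning

  middle-third : ∀ h l → (h + l) * 2 ≤ 3 * (h * 2) → 3 * (h * 2) ≤ 2 * ((h + l) * 2) →
    h + l ≤ 3 * h × h + l ≤ 3 * l
  middle-third h l lo hi = q≤3h , q≤3l
    where
    open ≤-Reasoning
    q≤3h : h + l ≤ 3 * h
    q≤3h = *-cancelʳ-≤ (h + l) (3 * h) 2 (≤-trans lo (≤-reflexive (sym (*-assoc 3 h 2))))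
    q≤3l : h + l ≤ 3 * l
    q≤3l = *-cancelˡ-≤ 2 (+-cancelʳ-≤ (4 * h) (2 * (h + l)) (2 * (3 * l)) (begin
      2 * (h + l) + 4 * h       ≡⟨ solve (h ∷ l ∷ []) ⟩
      3 * (h * 2) + 2 * l       ≤⟨ +-monoˡ-≤ (2 * l) hi ⟩
      2 * ((h + l) * 2) + 2 * l ≡⟨ solve (h ∷ l ∷ []) ⟩
      2 * (3 * l) + 4 * h       ∎))

  ∣m*o-n*o∣≡∣m-n∣*o : ∀ m n o → ∣ m * o - n * o ∣ ≡ ∣ m - n ∣ * o
  ∣m*o-n*o∣≡∣m-n∣*o zero    n       o = refl
  ∣m*o-n*o∣≡∣m-n∣*o (suc m) zero    o = ∣-∣-identityʳ (suc m * o)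
  ∣m*o-n*o∣≡∣m-n∣*o (suc m) (suc n) o =
    trans (∣m+n-m+o∣≡∣n-o∣ o (m * o) (n * o)) (∣m*o-n*o∣≡∣m-n∣*o m n o)

module BooleanCube where
  open import Algebra.Properties.CommutativeSemigroup using (interchange)
  open import Data.Bool using (Bool; true; false; _∧_; T)
  open import Data.Bool.Properties using (T-∧; ∧-zeroʳ)
  open import Data.Empty using (⊥-elim)
  open import Data.List using (_∷_; [])
  open import Data.Nat
  open import Data.Nat.Combinatorics using (_C_; nCk+nC[k+1]≡[n+1]C[k+1])
  open import Data.Nat.Divisibility using (_∣_; _∣?_; divides; ∣m+n∣m⇒∣n)
  open import Data.Nat.Properties
  open import Data.Nat.Tactic.RingSolver using (solve; solve-∀)
  open import Data.Product using (_×_; _,_; ∃₂; proj₁; proj₂)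
  open import Data.Vec using ([]; _∷_)
  open import Function.Bundles using (Equivalence)
  open import Relation.Binary.PropositionalEquality
  open import Relation.Nullary using (¬_; yes; no)

  open import Defs using (Cube; weight; _⊕_)
  open CentralBinomial

  ∑ : (n : ℕ) → (Cube n → ℕ) → ℕ
  ∑ zero    f = f []
  ∑ (suc n) f = ∑ n (λ x → f (false ∷ x)) + ∑ n (λ x → f (true ∷ x))

  ∑-cong : ∀ n {f g : Cube n → ℕ} → (∀ x → f x ≡ g x) → ∑ n f ≡ ∑ n g
  ∑-cong zero    f≗g = f≗g []
  ∑-cong (suc n) f≗g =
    cong₂ _+_ (∑-cong n (λ x → f≗g (false ∷ x))) (∑-cong n (λ x → f≗g (true ∷ x)))

  ∑-mono-≤ : ∀ n {f g : Cube n → ℕ} → (∀ x → f x ≤ g x) → ∑ n f ≤ ∑ n g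
  ∑-mono-≤ zero    f≤g = f≤g []
  ∑-mono-≤ (suc n) f≤g =
    +-mono-≤ (∑-mono-≤ n (λ x → f≤g (false ∷ x))) (∑-mono-≤ n (λ x → f≤g (true ∷ x)))

  ∑-distrib-+ : ∀ n (f g : Cube n → ℕ) → ∑ n (λ x → f x + g x) ≡ ∑ n f + ∑ n g
  ∑-distrib-+ zero    f g = refl
  ∑-distrib-+ (suc n) f g = trans (cong₂ _+_ (∑-distrib-+ n f₀ g₀) (∑-distrib-+ n f₁ g₁))
    (interchange +-commutativeSemigroup (∑ n f₀) (∑ n g₀) (∑ n f₁) (∑ n g₁))
    where
    f₀ f₁ g₀ g₁ : Cube n → ℕ
    f₀ x = f (false ∷ x)
    f₁ x = f (true ∷ x)
    g₀ x = g (false ∷ x)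
    g₁ x = g (true ∷ x)

  *-distribˡ-∑ : ∀ n k (f : Cube n → ℕ) → k * ∑ n f ≡ ∑ n (λ x → k * f x)
  *-distribˡ-∑ zero    k f = refl
  *-distribˡ-∑ (suc n) k f = trans (*-distribˡ-+ k _ _)
    (cong₂ _+_ (*-distribˡ-∑ n k (λ x → f (false ∷ x))) (*-distribˡ-∑ n k (λ x → f (true ∷ x))))

  ∑-const : ∀ n k → ∑ n (λ _ → k) ≡ k * 2 ^ n
  ∑-const zero    k = sym (*-identityʳ k)
  ∑-const (suc n) k = begin
    ∑ n (λ _ → k) + ∑ n (λ _ → k) ≡⟨ cong₂ _+_ (∑-const n k) (∑-const n k) ⟩
    k * 2 ^ n + k * 2 ^ n         ≡⟨ double k (2 ^ n) ⟩
    k * (2 * 2 ^ n)               ∎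
    where
    open ≡-Reasoning
    double : ∀ k p → k * p + k * p ≡ k * (2 * p)
    double = solve-∀

  𝟙 : Bool → ℕ
  𝟙 true  = 1
  𝟙 false = 0

  𝟙-mono : ∀ {a b} → (T a → T b) → 𝟙 a ≤ 𝟙 b
  𝟙-mono {false}         _   = z≤n
  𝟙-mono {true}  {true}  _   = ≤-refl
  𝟙-mono {true}  {false} a⇒b = ⊥-elim (a⇒b _)

  zeros : ∀ {n} → Cube n → ℕ
  zeros []          = 0
  zeros (false ∷ x) = suc (zeros x)
  zeros (true ∷ x)  = zeros x

  weight+zeros≡n : ∀ {n} (x : Cube n) → weight x + zeros x ≡ n
  weight+zeros≡n []          = refl
  weight+zeros≡n (true ∷ x)  = cong suc (weight+zeros≡n x)
  weight+zeros≡n (false ∷ x) = trans (+-suc (weight x) (zeros x)) (cong suc (weight+zeros≡n x))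

  weightInside : ∀ {n} → Cube n → Cube n → ℕ
  weightInside []          []          = 0
  weightInside (true ∷ x)  (true ∷ y)  = suc (weightInside x y)
  weightInside (true ∷ x)  (false ∷ y) = weightInside x y
  weightInside (false ∷ x) (_ ∷ y)     = weightInside x y

  weightOutside : ∀ {n} → Cube n → Cube n → ℕ
  weightOutside []          []          = 0
  weightOutside (false ∷ x) (true ∷ y)  = suc (weightOutside x y)
  weightOutside (false ∷ x) (false ∷ y) = weightOutside x y
  weightOutside (true ∷ x)  (_ ∷ y)     = weightOutside x y

  weight≡inside+outside : ∀ {n} (x y : Cube n) → weight y ≡ weightInside x y + weightOutside x y
  weight≡inside+outside []          []          = refl
  weight≡inside+outside (true ∷ x)  (true ∷ y)  = cong suc (weight≡inside+outside x y)
  weight≡inside+outside (true ∷ x)  (false ∷ y) = weight≡inside+outside x y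
  weight≡inside+outside (false ∷ x) (true ∷ y)  =
    trans (cong suc (weight≡inside+outside x y)) (sym (+-suc (weightInside x y) (weightOutside x y)))
  weight≡inside+outside (false ∷ x) (false ∷ y) = weight≡inside+outside x y

  weight-⊕ : ∀ {n} (x y : Cube n) → weight (x ⊕ y) + weightInside x y ≡ weight x + weightOutside x y
  weight-⊕ []          []          = refl
  weight-⊕ (true ∷ x)  (true ∷ y)  = trans (+-suc (weight (x ⊕ y)) (weightInside x y)) (cong suc (weight-⊕ x y))
  weight-⊕ (true ∷ x)  (false ∷ y) = cong suc (weight-⊕ x y)
  weight-⊕ (false ∷ x) (true ∷ y)  = trans (cong suc (weight-⊕ x y)) (sym (+-suc (weight x) (weightOutside x y)))
  weight-⊕ (false ∷ x) (false ∷ y) = weight-⊕ x y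

  nC[k+1]+nCk≡[n+1]C[k+1] : ∀ n k → n C suc k + n C k ≡ suc n C suc k
  nC[k+1]+nCk≡[n+1]C[k+1] n k = trans (+-comm (n C suc k) (n C k)) (nCk+nC[k+1]≡[n+1]C[k+1] n k)

  ∑-inside-outside : ∀ {n} (x : Cube n) i j →
    ∑ n (λ y → 𝟙 ((weightInside x y ≡ᵇ i) ∧ (weightOutside x y ≡ᵇ j))) ≡ (weight x C i) * (zeros x C j)
  ∑-inside-outside []          zero    zero    = refl
  ∑-inside-outside []          zero    (suc j) = refl
  ∑-inside-outside []          (suc i) j       = refl
  ∑-inside-outside {suc n} (true ∷ x)  zero    j =
    trans (cong₂ _+_ (∑-inside-outside x zero j) (∑-const n 0)) (+-identityʳ _)
  ∑-inside-outside {suc n} (true ∷ x)  (suc i) j = begin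
    ∑ n (λ y → 𝟙 ((weightInside x y ≡ᵇ suc i) ∧ (weightOutside x y ≡ᵇ j)))
      + ∑ n (λ y → 𝟙 ((weightInside x y ≡ᵇ i) ∧ (weightOutside x y ≡ᵇ j)))
      ≡⟨ cong₂ _+_ (∑-inside-outside x (suc i) j) (∑-inside-outside x i j) ⟩
    (weight x C suc i) * (zeros x C j) + (weight x C i) * (zeros x C j)
      ≡⟨ *-distribʳ-+ (zeros x C j) (weight x C suc i) (weight x C i) ⟨
    ((weight x C suc i) + (weight x C i)) * (zeros x C j)
      ≡⟨ cong (_* (zeros x C j)) (nC[k+1]+nCk≡[n+1]C[k+1] (weight x) i) ⟩
    (suc (weight x) C suc i) * (zeros x C j) ∎
    where open ≡-Reasoning
  ∑-inside-outside {suc n} (false ∷ x) i       zero    =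
    trans (cong₂ _+_ (∑-inside-outside x i zero) none) (+-identityʳ _)
    where
    none : ∑ n (λ y → 𝟙 ((weightInside x y ≡ᵇ i) ∧ false)) ≡ 0
    none = trans (∑-cong n (λ y → cong 𝟙 (∧-zeroʳ (weightInside x y ≡ᵇ i)))) (∑-const n 0)
  ∑-inside-outside {suc n} (false ∷ x) i       (suc j) = begin
    ∑ n (λ y → 𝟙 ((weightInside x y ≡ᵇ i) ∧ (weightOutside x y ≡ᵇ suc j)))
      + ∑ n (λ y → 𝟙 ((weightInside x y ≡ᵇ i) ∧ (weightOutside x y ≡ᵇ j)))
      ≡⟨ cong₂ _+_ (∑-inside-outside x i (suc j)) (∑-inside-outside x i j) ⟩
    (weight x C i) * (zeros x C suc j) + (weight x C i) * (zeros x C j)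
      ≡⟨ *-distribˡ-+ (weight x C i) (zeros x C suc j) (zeros x C j) ⟨
    (weight x C i) * ((zeros x C suc j) + (zeros x C j))
      ≡⟨ cong ((weight x C i) *_) (nC[k+1]+nCk≡[n+1]C[k+1] (zeros x) j) ⟩
    (weight x C i) * (suc (zeros x) C suc j) ∎
    where open ≡-Reasoning

  weightInside*2≡weight : ∀ {n} (x y : Cube n) → weight y ≡ weight (x ⊕ y) → weightInside x y * 2 ≡ weight x
  weightInside*2≡weight x y |y|≡|x⊕y| = +-cancelʳ-≡ b (a * 2) (weight x) (begin
    a * 2 + b          ≡⟨ regroup a b ⟩
    (a + b) + a        ≡⟨ cong (_+ a) (weight≡inside+outside x y) ⟨
    weight y + a       ≡⟨ cong (_+ a) |y|≡|x⊕y| ⟩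
    weight (x ⊕ y) + a ≡⟨ weight-⊕ x y ⟩
    weight x + b       ∎)
    where
    open ≡-Reasoning
    a b : ℕ
    a = weightInside x y
    b = weightOutside x y
    regroup : ∀ a b → a * 2 + b ≡ (a + b) + a
    regroup = solve-∀

  slicePairs : ∀ {n} → ℕ → Cube n → ℕ
  slicePairs {n} m x = ∑ n (λ y → 𝟙 ((weight y ≡ᵇ m) ∧ (weight (x ⊕ y) ≡ᵇ m)))

  slicePairs-odd : ∀ {n} m (x : Cube n) → ¬ 2 ∣ weight x → slicePairs m x ≡ 0
  slicePairs-odd {n} m x odd = n≤0⇒n≡0 (begin
    slicePairs m x  ≤⟨ ∑-mono-≤ n (λ y → 𝟙-mono (λ t → odd (even y t))) ⟩
    ∑ n (λ _ → 0)   ≡⟨ ∑-const n 0 ⟩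
    0               ∎)
    where
    open ≤-Reasoning
    even : ∀ y → T ((weight y ≡ᵇ m) ∧ (weight (x ⊕ y) ≡ᵇ m)) → 2 ∣ weight x
    even y t = divides (weightInside x y) (sym (weightInside*2≡weight x y
      (trans (≡ᵇ⇒≡ _ _ (Equivalence.to T-∧ t .proj₁)) (sym (≡ᵇ⇒≡ _ _ (Equivalence.to T-∧ t .proj₂))))))

  slicePairs-even : ∀ {n h} m (x : Cube n) → weight x ≡ h * 2 →
    slicePairs m x ≤ centralBinomial h * (zeros x C (m ∸ h))
  slicePairs-even {n} {h} m x |x|≡h*2 = begin
    slicePairs m x
      ≤⟨ ∑-mono-≤ n (λ y → 𝟙-mono (λ t → Equivalence.from T-∧ (split y (Equivalence.to T-∧ t)))) ⟩
    ∑ n (λ y → 𝟙 ((weightInside x y ≡ᵇ h) ∧ (weightOutside x y ≡ᵇ m ∸ h)))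
      ≡⟨ ∑-inside-outside x h (m ∸ h) ⟩
    (weight x C h) * (zeros x C (m ∸ h))
      ≡⟨ cong (λ w → (w C h) * (zeros x C (m ∸ h))) |x|≡h*2 ⟩
    centralBinomial h * (zeros x C (m ∸ h))
      ∎
    where
    open ≤-Reasoning
    split : ∀ y → T (weight y ≡ᵇ m) × T (weight (x ⊕ y) ≡ᵇ m) →
            T (weightInside x y ≡ᵇ h) × T (weightOutside x y ≡ᵇ m ∸ h)
    split y (|y|≡m , |x⊕y|≡m) = ≡⇒≡ᵇ _ _ inside≡h , ≡⇒≡ᵇ _ _ outside≡m∸h
      where
      inside≡h : weightInside x y ≡ h
      inside≡h = *-cancelʳ-≡ _ _ 2 (trans (weightInside*2≡weight x y
        (trans (≡ᵇ⇒≡ _ _ |y|≡m) (sym (≡ᵇ⇒≡ _ _ |x⊕y|≡m)))) |x|≡h*2)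
      outside≡m∸h : weightOutside x y ≡ m ∸ h
      outside≡m∸h = sym (begin-equality
        m ∸ h
          ≡⟨ cong₂ _∸_ (trans (sym (≡ᵇ⇒≡ _ _ |y|≡m)) (weight≡inside+outside x y)) (sym inside≡h) ⟩
        weightInside x y + weightOutside x y ∸ weightInside x y
          ≡⟨ m+n∸m≡n (weightInside x y) (weightOutside x y) ⟩
        weightOutside x y ∎)

  even-weight-split : ∀ q (x : Cube (q * 2)) → 2 ∣ weight x →
    ∃₂ λ h l → h + l ≡ q × weight x ≡ h * 2 × zeros x ≡ l * 2
  even-weight-split q x (divides h |x|≡h*2)
    with ∣m+n∣m⇒∣n (divides q (weight+zeros≡n x)) (divides h |x|≡h*2)
  ... | divides l zeros≡l*2 = h , l , h+l≡q , |x|≡h*2 , zeros≡l*2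
    where
    h+l≡q : h + l ≡ q
    h+l≡q = *-cancelʳ-≡ (h + l) q 2 (begin
      (h + l) * 2         ≡⟨ *-distribʳ-+ 2 h l ⟩
      h * 2 + l * 2       ≡⟨ cong₂ _+_ |x|≡h*2 zeros≡l*2 ⟨
      weight x + zeros x  ≡⟨ weight+zeros≡n x ⟩
      q * 2               ∎)
      where open ≡-Reasoning

  2^[n*2]≡4^n : ∀ n → 2 ^ (n * 2) ≡ 4 ^ n
  2^[n*2]≡4^n n = trans (cong (2 ^_) (*-comm n 2)) (sym (^-*-assoc 2 2 n))

  slicePairs-even-bound : ∀ h l (x : Cube ((h + l) * 2)) → weight x ≡ h * 2 → zeros x ≡ l * 2 →
    slicePairs (h + l) x * 2 ^ ((h + l) * 2) ≤ convolutionNumerator h l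
  slicePairs-even-bound h l x |x|≡h*2 zeros≡l*2 = begin
    slicePairs (h + l) x * 2 ^ ((h + l) * 2)
      ≤⟨ *-monoˡ-≤ (2 ^ ((h + l) * 2)) (slicePairs-even {h = h} (h + l) x |x|≡h*2) ⟩
    centralBinomial h * (zeros x C (h + l ∸ h)) * 2 ^ ((h + l) * 2)
      ≡⟨ cong₂ (λ c p → centralBinomial h * c * p) (cong₂ _C_ zeros≡l*2 (m+n∸m≡n h l)) (2^[n*2]≡4^n (h + l)) ⟩
    convolutionNumerator h l
      ∎
    where open ≤-Reasoning

  slicePairs-middle-< : ∀ q (x : Cube (q * 2)) → q * 2 ≤ 3 * weight x → 3 * weight x ≤ 2 * (q * 2) →
    slicePairs q x * 2 ^ (q * 2) < 4 * (centralBinomial q * centralBinomial q)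
  slicePairs-middle-< q x lo hi with 2 ∣? weight x
  ... | no odd rewrite slicePairs-odd q x odd = *-monoʳ-< 4 (*-mono-< B>0 B>0)
    where
    B>0 : 0 < centralBinomial q
    B>0 = >-nonZero⁻¹ (centralBinomial q) {{centralBinomial-nonZero q}}
  ... | yes even with even-weight-split q x even
  ...   | h , l , refl , |x|≡h*2 , zeros≡l*2
    with middle-third h l (subst (λ w → (h + l) * 2 ≤ 3 * w) |x|≡h*2 lo)
                          (subst (λ w → 3 * w ≤ 2 * ((h + l) * 2)) |x|≡h*2 hi)
  ...   | q≤3h , q≤3l =
    ≤-<-trans (slicePairs-even-bound h l x |x|≡h*2 zeros≡l*2) (convolutionNumerator-< h l q≤3h q≤3l)

  imbalance : ∀ {n} → Cube n → ℕ
  imbalance x = ∣ weight x - zeros x ∣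

  -- (m + 1, n) and (m, n + 1) are at distance d ± 1 from the diagonal, d = ∣ m - n ∣ (both at 1 if d = 0).
  ∣-∣-neighbours : ∀ (f g : ℕ → ℕ) → f 1 + f 1 ≡ g 0 → (∀ d → f (2 + d) + f d ≡ g (suc d)) →
    ∀ m n → f ∣ suc m - n ∣ + f ∣ m - suc n ∣ ≡ g ∣ m - n ∣
  ∣-∣-neighbours f g base step zero    zero    = base
  ∣-∣-neighbours f g base step zero    (suc n) = trans (+-comm (f n) (f (2 + n))) (step n)
  ∣-∣-neighbours f g base step (suc m) zero    = trans (cong (λ d → f (2 + m) + f d) (∣-∣-identityʳ m)) (step m)
  ∣-∣-neighbours f g base step (suc m) (suc n) = ∣-∣-neighbours f g base step m n

  ∑-imbalance-suc : ∀ n (f g : ℕ → ℕ) → f 1 + f 1 ≡ g 0 → (∀ d → f (2 + d) + f d ≡ g (suc d)) →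
    ∑ (suc n) (λ x → f (imbalance x)) ≡ ∑ n (λ x → g (imbalance x))
  ∑-imbalance-suc n f g base step = begin
    ∑ n down + ∑ n up              ≡⟨ +-comm (∑ n down) (∑ n up) ⟩
    ∑ n up + ∑ n down              ≡⟨ ∑-distrib-+ n up down ⟨
    ∑ n (λ x → up x + down x)      ≡⟨ ∑-cong n (λ x → ∣-∣-neighbours f g base step (weight x) (zeros x)) ⟩
    ∑ n (λ x → g (imbalance x))    ∎
    where
    open ≡-Reasoning
    up down : Cube n → ℕ
    up   x = f ∣ suc (weight x) - zeros x ∣
    down x = f ∣ weight x - suc (zeros x) ∣

  ∑-affine : ∀ n a b (f : Cube n → ℕ) → ∑ n (λ x → a * f x + b) ≡ a * ∑ n f + b * 2 ^ n
  ∑-affine n a b f = begin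
    ∑ n (λ x → a * f x + b)          ≡⟨ ∑-distrib-+ n (λ x → a * f x) (λ _ → b) ⟩
    ∑ n (λ x → a * f x) + ∑ n (λ _ → b) ≡⟨ cong₂ _+_ (sym (*-distribˡ-∑ n a f)) (∑-const n b) ⟩
    a * ∑ n f + b * 2 ^ n             ∎
    where open ≡-Reasoning

  ∑-imbalance² : ∀ n → ∑ n (λ x → imbalance x * imbalance x) ≡ n * 2 ^ n
  ∑-imbalance² zero    = refl
  ∑-imbalance² (suc n) = begin
    ∑ (suc n) (λ x → imbalance x * imbalance x)
      ≡⟨ ∑-imbalance-suc n (λ d → d * d) (λ d → 2 * (d * d) + 2) refl step ⟩
    ∑ n (λ x → 2 * (imbalance x * imbalance x) + 2)
      ≡⟨ ∑-affine n 2 2 (λ x → imbalance x * imbalance x) ⟩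
    2 * ∑ n (λ x → imbalance x * imbalance x) + 2 * 2 ^ n
      ≡⟨ cong (λ s → 2 * s + 2 * 2 ^ n) (∑-imbalance² n) ⟩
    2 * (n * 2 ^ n) + 2 * 2 ^ n
      ≡⟨ regroup n (2 ^ n) ⟩
    suc n * 2 ^ suc n
      ∎
    where
    open ≡-Reasoning
    step : ∀ d → (2 + d) * (2 + d) + d * d ≡ 2 * (suc d * suc d) + 2
    step = solve-∀
    regroup : ∀ n p → 2 * (n * p) + 2 * p ≡ suc n * (2 * p)
    regroup = solve-∀

  ∑-imbalance⁴ : ∀ n →
    ∑ n (λ x → imbalance x * imbalance x * (imbalance x * imbalance x)) + 2 * n * 2 ^ n ≡ 3 * (n * n) * 2 ^ n
  ∑-imbalance⁴ zero    = refl
  ∑-imbalance⁴ (suc n) = begin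
    ∑ (suc n) (λ x → imbalance x * imbalance x * (imbalance x * imbalance x)) + 2 * suc n * 2 ^ suc n
      ≡⟨ cong (_+ 2 * suc n * 2 ^ suc n) (∑-imbalance-suc n (λ d → d * d * (d * d))
           (λ d → 2 * (d * d * (d * d) + 6 * (d * d)) + 2) refl step) ⟩
    ∑ n (λ x → 2 * (d⁴ x + 6 * d² x) + 2) + 2 * suc n * 2 ^ suc n
      ≡⟨ cong (_+ 2 * suc n * 2 ^ suc n) (∑-affine n 2 2 (λ x → d⁴ x + 6 * d² x)) ⟩
    2 * ∑ n (λ x → d⁴ x + 6 * d² x) + 2 * 2 ^ n + 2 * suc n * 2 ^ suc n
      ≡⟨ cong (λ s → 2 * s + 2 * 2 ^ n + 2 * suc n * 2 ^ suc n)
           (trans (∑-distrib-+ n d⁴ (λ x → 6 * d² x)) (cong (S⁴ +_) (sym (*-distribˡ-∑ n 6 d²)))) ⟩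
    2 * (S⁴ + 6 * ∑ n d²) + 2 * 2 ^ n + 2 * suc n * 2 ^ suc n
      ≡⟨ cong (λ s → 2 * (S⁴ + 6 * s) + 2 * 2 ^ n + 2 * suc n * 2 ^ suc n) (∑-imbalance² n) ⟩
    2 * (S⁴ + 6 * (n * 2 ^ n)) + 2 * 2 ^ n + 2 * suc n * (2 * 2 ^ n)
      ≡⟨ regroupˡ S⁴ n (2 ^ n) ⟩
    2 * (S⁴ + 2 * n * 2 ^ n) + 6 * (2 * n + 1) * 2 ^ n
      ≡⟨ cong (λ s → 2 * s + 6 * (2 * n + 1) * 2 ^ n) (∑-imbalance⁴ n) ⟩
    2 * (3 * (n * n) * 2 ^ n) + 6 * (2 * n + 1) * 2 ^ n
      ≡⟨ regroupʳ n (2 ^ n) ⟩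
    3 * (suc n * suc n) * 2 ^ suc n
      ∎
    where
    open ≡-Reasoning
    d² d⁴ : Cube n → ℕ
    d² x = imbalance x * imbalance x
    d⁴ x = d² x * d² x
    S⁴ : ℕ
    S⁴ = ∑ n d⁴
    step : ∀ d → (2 + d) * (2 + d) * ((2 + d) * (2 + d)) + d * d * (d * d)
               ≡ 2 * (suc d * suc d * (suc d * suc d) + 6 * (suc d * suc d)) + 2
    step = solve-∀
    regroupˡ : ∀ s n p → 2 * (s + 6 * (n * p)) + 2 * p + 2 * suc n * (2 * p)
                       ≡ 2 * (s + 2 * n * p) + 6 * (2 * n + 1) * p
    regroupˡ = solve-∀
    regroupʳ : ∀ n p → 2 * (3 * (n * n) * p) + 6 * (2 * n + 1) * p ≡ 3 * (suc n * suc n) * (2 * p)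
    regroupʳ = solve-∀

  slicePairs⁴-bound : ∀ q .{{_ : NonZero q}} (x : Cube (q * 2)) →
    let A = slicePairs q x * 2 ^ (q * 2) ; B = centralBinomial q ; d = imbalance x in
    q * q * (A * A * (A * A)) ≤ B * B * (B * B) * (B * B * (B * B)) * (64 * (d * d * (d * d)) + 256 * (q * q))
  slicePairs⁴-bound q x with 2 ∣? weight x
  ... | no odd rewrite slicePairs-odd q x odd | *-zeroʳ (q * q) = z≤n
  ... | yes even with even-weight-split q x even
  ...   | h , l , refl , |x|≡h*2 , zeros≡l*2 = begin
    (h + l) * (h + l) * (A * A * (A * A))
      ≤⟨ *-monoʳ-≤ ((h + l) * (h + l)) (*-mono-≤ (*-mono-≤ A≤X A≤X) (*-mono-≤ A≤X A≤X)) ⟩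
    (h + l) * (h + l) * (X * X * (X * X))
      ≤⟨ convolutionNumerator⁴-bound h l ⟩
    B⁸ * (256 * ((h + l) * (h + l)) + 1024 * (e * e * (e * e)))
      ≡⟨ cong (B⁸ *_) (+-comm (256 * ((h + l) * (h + l))) (1024 * (e * e * (e * e)))) ⟩
    B⁸ * (1024 * (e * e * (e * e)) + 256 * ((h + l) * (h + l)))
      ≡⟨ cong (λ t → B⁸ * (t + 256 * ((h + l) * (h + l)))) 1024e⁴≡64d⁴ ⟩
    B⁸ * (64 * (d * d * (d * d)) + 256 * ((h + l) * (h + l)))
      ∎
    where
    open ≤-Reasoning
    A X B⁸ d e : ℕ
    A = slicePairs (h + l) x * 2 ^ ((h + l) * 2)
    X = convolutionNumerator h l
    B⁸ = let B = centralBinomial (h + l) in B * B * (B * B) * (B * B * (B * B))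
    d = imbalance x
    e = ∣ h - l ∣
    A≤X : A ≤ X
    A≤X = slicePairs-even-bound h l x |x|≡h*2 zeros≡l*2
    scale : ∀ e → 1024 * (e * e * (e * e)) ≡ 64 * (e * 2 * (e * 2) * (e * 2 * (e * 2)))
    scale = solve-∀
    1024e⁴≡64d⁴ : 1024 * (e * e * (e * e)) ≡ 64 * (d * d * (d * d))
    1024e⁴≡64d⁴ = trans (scale e) (cong (λ t → 64 * (t * t * (t * t)))
      (sym (trans (cong₂ ∣_-_∣ |x|≡h*2 zeros≡l*2) (∣m*o-n*o∣≡∣m-n∣*o h l 2))))

  ∑-slicePairs⁴-bound : ∀ q → let n = q * 2 ; B = centralBinomial q in
    ∑ n (λ x → let A = slicePairs q x * 2 ^ n in A * A * (A * A))
      ≤ 1024 * (B * B * (B * B) * (B * B * (B * B)) * 2 ^ n)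
  ∑-slicePairs⁴-bound zero        = s≤s z≤n
  ∑-slicePairs⁴-bound q@(suc _) = *-cancelˡ-≤ (q * q) (begin
    q * q * ∑ n A⁴
      ≡⟨ *-distribˡ-∑ n (q * q) A⁴ ⟩
    ∑ n (λ x → q * q * A⁴ x)
      ≤⟨ ∑-mono-≤ n (slicePairs⁴-bound q) ⟩
    ∑ n (λ x → B⁸ * (64 * d⁴ x + 256 * (q * q)))
      ≡⟨ *-distribˡ-∑ n B⁸ (λ x → 64 * d⁴ x + 256 * (q * q)) ⟨
    B⁸ * ∑ n (λ x → 64 * d⁴ x + 256 * (q * q))
      ≡⟨ cong (B⁸ *_) (∑-affine n 64 (256 * (q * q)) d⁴) ⟩
    B⁸ * (64 * ∑ n d⁴ + 256 * (q * q) * 2 ^ n)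
      ≤⟨ *-monoʳ-≤ B⁸ (+-monoˡ-≤ (256 * (q * q) * 2 ^ n) (*-monoʳ-≤ 64 fourth-moment)) ⟩
    B⁸ * (64 * (3 * (n * n) * 2 ^ n) + 256 * (q * q) * 2 ^ n)
      ≡⟨ regroup q B⁸ (2 ^ n) ⟩
    q * q * (1024 * (B⁸ * 2 ^ n))
      ∎)
    where
    open ≤-Reasoning
    n B⁸ : ℕ
    n = q * 2
    B⁸ = let B = centralBinomial q in B * B * (B * B) * (B * B * (B * B))
    A⁴ d⁴ : Cube n → ℕ
    A⁴ x = let A = slicePairs q x * 2 ^ n in A * A * (A * A)
    d⁴ x = imbalance x * imbalance x * (imbalance x * imbalance x)
    fourth-moment : ∑ n d⁴ ≤ 3 * (n * n) * 2 ^ n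
    fourth-moment = subst (∑ n d⁴ ≤_) (∑-imbalance⁴ n) (m≤m+n (∑ n d⁴) (2 * n * 2 ^ n))
    regroup : ∀ q b p → b * (64 * (3 * (q * 2 * (q * 2)) * p) + 256 * (q * q) * p) ≡ q * q * (1024 * (b * p))
    regroup = solve-∀

module Rationals where
  open import Algebra.Bundles using (CommutativeMonoid)
  open import Algebra.Properties.CommutativeSemigroup using (interchange)
  open import Data.Bool using (true; false; if_then_else_; _∧_)
  open import Data.Integer as ℤ using (+_)
  import Data.Integer.Properties as ℤ
  open import Data.List using (List; []; _∷_; map; _++_)
  import Data.List.Properties as List
  open import Data.Nat as ℕ using (ℕ; zero; suc; NonZero)
  open import Data.Nat.Combinatorics using (_C_)
  import Data.Nat.Coprimality as Coprime
  open import Data.Nat.DivMod using (m/n≤m; m*n/n≡m)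
  import Data.Nat.Properties as ℕ
  open import Data.Rational using (ℚ; mkℚ; 0ℚ; 1ℚ; _+_; _*_; _<_; _≤_; *<*; *≤*; Positive; NonNegative)
  import Data.Rational.Properties as ℚ
  open import Data.Rational.Solver using (module +-*-Solver)
  open import Data.Rational.Unnormalised using (*≡*)
  import Data.Rational.Unnormalised.Properties as ℚᵘ
  open import Data.Vec using ([]; _∷_)
  open import Function using (_∘_)
  open import Relation.Binary.PropositionalEquality

  open import Defs
  open CentralBinomial using (nCk≢0; centralBinomial; centralBinomial-nonZero)
  open BooleanCube using (∑; 𝟙; slicePairs; slicePairs-middle-<; ∑-slicePairs⁴-bound)

  private
    canonical : ℕ → ℚ
    canonical n = mkℚ (+ n) 0 (Coprime.sym (Coprime.1-coprimeTo n))

    natℚ≡canonical : ∀ n → natℚ n ≡ canonical n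
    natℚ≡canonical n = ℚ.normalize-coprime (Coprime.sym (Coprime.1-coprimeTo n))

  natℚ-+ : ∀ m n → natℚ (m ℕ.+ n) ≡ natℚ m + natℚ n
  natℚ-+ m n rewrite natℚ≡canonical (m ℕ.+ n) | natℚ≡canonical m | natℚ≡canonical n =
    ℚ.toℚᵘ-injective (ℚᵘ.≃-trans (*≡* eq) (ℚᵘ.≃-sym (ℚ.toℚᵘ-homo-+ (canonical m) (canonical n))))
    where
    open ≡-Reasoning
    eq : + (m ℕ.+ n) ℤ.* + 1 ≡ (+ m ℤ.* + 1 ℤ.+ + n ℤ.* + 1) ℤ.* + 1
    eq = begin
      + (m ℕ.+ n) ℤ.* + 1                   ≡⟨ ℤ.*-identityʳ _ ⟩
      + m ℤ.+ + n                           ≡⟨ cong₂ ℤ._+_ (ℤ.*-identityʳ (+ m)) (ℤ.*-identityʳ (+ n)) ⟨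
      + m ℤ.* + 1 ℤ.+ + n ℤ.* + 1           ≡⟨ ℤ.*-identityʳ _ ⟨
      (+ m ℤ.* + 1 ℤ.+ + n ℤ.* + 1) ℤ.* + 1 ∎

  natℚ-* : ∀ m n → natℚ (m ℕ.* n) ≡ natℚ m * natℚ n
  natℚ-* m n rewrite natℚ≡canonical (m ℕ.* n) | natℚ≡canonical m | natℚ≡canonical n =
    ℚ.toℚᵘ-injective (ℚᵘ.≃-trans (*≡* (cong (ℤ._* + 1) (ℤ.pos-* m n)))
                                 (ℚᵘ.≃-sym (ℚ.toℚᵘ-homo-* (canonical m) (canonical n))))

  natℚ-mono-≤ : ∀ {m n} → m ℕ.≤ n → natℚ m ≤ natℚ n
  natℚ-mono-≤ {m} {n} m≤n rewrite natℚ≡canonical m | natℚ≡canonical n =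
    *≤* (subst₂ ℤ._≤_ (sym (ℤ.*-identityʳ (+ m))) (sym (ℤ.*-identityʳ (+ n))) (ℤ.+≤+ m≤n))

  natℚ-mono-< : ∀ {m n} → m ℕ.< n → natℚ m < natℚ n
  natℚ-mono-< {m} {n} m<n rewrite natℚ≡canonical m | natℚ≡canonical n =
    *<* (subst₂ ℤ._<_ (sym (ℤ.*-identityʳ (+ m))) (sym (ℤ.*-identityʳ (+ n))) (ℤ.+<+ m<n))

  natℚ-nonNeg : ∀ n → NonNegative (natℚ n)
  natℚ-nonNeg n rewrite natℚ≡canonical n = _

  natℚ-pos : ∀ n .{{_ : NonZero n}} → Positive (natℚ n)
  natℚ-pos (suc n) rewrite natℚ≡canonical (suc n) = _

  recip*natℚ≡1 : ∀ n .{{_ : NonZero n}} → recip n * natℚ n ≡ 1ℚ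
  recip*natℚ≡1 (suc n) rewrite natℚ≡canonical (suc n) | ℚ.normalize-coprime (Coprime.1-coprimeTo (suc n)) =
    ℚ.toℚᵘ-injective (ℚᵘ.≃-trans (ℚ.toℚᵘ-homo-* (mkℚ (+ 1) n (Coprime.1-coprimeTo (suc n))) (canonical (suc n)))
                                 (*≡* eq))
    where
    eq : (+ 1 ℤ.* + suc n) ℤ.* + 1 ≡ + 1 ℤ.* + (suc n ℕ.* 1)
    eq = trans (ℤ.*-identityʳ _) (cong (λ m → + 1 ℤ.* + m) (sym (ℕ.*-identityʳ (suc n))))

  -- p * natℚ k ≡ natℚ a expresses p = a / k, so that every estimate can be proved in ℕ.
  *-scaled : ∀ {p q k l a b} → p * natℚ k ≡ natℚ a → q * natℚ l ≡ natℚ b →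
             p * q * natℚ (k ℕ.* l) ≡ natℚ (a ℕ.* b)
  *-scaled {p} {q} {k} {l} {a} {b} pk≡a ql≡b = begin
    p * q * natℚ (k ℕ.* l)      ≡⟨ cong (p * q *_) (natℚ-* k l) ⟩
    p * q * (natℚ k * natℚ l)   ≡⟨ interchange commutativeSemigroup p q (natℚ k) (natℚ l) ⟩
    p * natℚ k * (q * natℚ l)   ≡⟨ cong₂ _*_ pk≡a ql≡b ⟩
    natℚ a * natℚ b             ≡⟨ natℚ-* a b ⟨
    natℚ (a ℕ.* b)              ∎
    where
    open ≡-Reasoning
    open CommutativeMonoid ℚ.*-1-commutativeMonoid using (commutativeSemigroup)

  <-of-scaled : ∀ {p k a m} → p * natℚ k ≡ natℚ a → a ℕ.< m ℕ.* k → p < natℚ m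
  <-of-scaled {p} {k} {a} {m} pk≡a a<mk = ℚ.*-cancelʳ-<-nonNeg (natℚ k) {{natℚ-nonNeg k}} (begin-strict
    p * natℚ k      ≡⟨ pk≡a ⟩
    natℚ a          <⟨ natℚ-mono-< a<mk ⟩
    natℚ (m ℕ.* k)  ≡⟨ natℚ-* m k ⟩
    natℚ m * natℚ k ∎)
    where open ℚ.≤-Reasoning

  ≤-of-scaled : ∀ {p k a m} .{{_ : NonZero k}} → p * natℚ k ≡ natℚ a → a ℕ.≤ m ℕ.* k → p ≤ natℚ m
  ≤-of-scaled {p} {k} {a} {m} pk≡a a≤mk = ℚ.*-cancelʳ-≤-pos (natℚ k) {{natℚ-pos k}} (begin
    p * natℚ k      ≡⟨ pk≡a ⟩
    natℚ a          ≤⟨ natℚ-mono-≤ a≤mk ⟩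
    natℚ (m ℕ.* k)  ≡⟨ natℚ-* m k ⟩
    natℚ m * natℚ k ∎)
    where open ℚ.≤-Reasoning

  sumℚ-++ : ∀ xs ys → sumℚ (xs ++ ys) ≡ sumℚ xs + sumℚ ys
  sumℚ-++ []       ys = sym (ℚ.+-identityˡ (sumℚ ys))
  sumℚ-++ (x ∷ xs) ys = trans (cong (_+_ x) (sumℚ-++ xs ys)) (sym (ℚ.+-assoc x (sumℚ xs) (sumℚ ys)))

  sumℚ-allPts : ∀ n {r} (f : Cube n → ℚ) (g : Cube n → ℕ) → (∀ x → f x ≡ natℚ (g x) * r) →
    sumℚ (map f (allPts n)) ≡ natℚ (∑ n g) * r
  sumℚ-allPts zero          f g f≡gr = trans (ℚ.+-identityʳ (f [])) (f≡gr [])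
  sumℚ-allPts (suc n) {r} f g f≡gr = begin
    sumℚ (map f (map (false ∷_) xs ++ map (true ∷_) xs))
      ≡⟨ cong sumℚ (List.map-++ f (map (false ∷_) xs) (map (true ∷_) xs)) ⟩
    sumℚ (map f (map (false ∷_) xs) ++ map f (map (true ∷_) xs))
      ≡⟨ sumℚ-++ (map f (map (false ∷_) xs)) (map f (map (true ∷_) xs)) ⟩
    sumℚ (map f (map (false ∷_) xs)) + sumℚ (map f (map (true ∷_) xs))
      ≡⟨ cong₂ (λ ys zs → sumℚ ys + sumℚ zs) (List.map-∘ xs) (List.map-∘ xs) ⟨
    sumℚ (map f₀ xs) + sumℚ (map f₁ xs)
      ≡⟨ cong₂ _+_ (sumℚ-allPts n f₀ g₀ (f≡gr ∘ (false ∷_))) (sumℚ-allPts n f₁ g₁ (f≡gr ∘ (true ∷_))) ⟩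
    natℚ (∑ n g₀) * r + natℚ (∑ n g₁) * r
      ≡⟨ ℚ.*-distribʳ-+ r (natℚ (∑ n g₀)) (natℚ (∑ n g₁)) ⟨
    (natℚ (∑ n g₀) + natℚ (∑ n g₁)) * r
      ≡⟨ cong (_* r) (natℚ-+ (∑ n g₀) (∑ n g₁)) ⟨
    natℚ (∑ (suc n) g) * r
      ∎
    where
    open ≡-Reasoning
    xs : List (Cube n)
    xs = allPts n
    f₀ f₁ : Cube n → ℚ
    f₀ = f ∘ (false ∷_)
    f₁ = f ∘ (true ∷_)
    g₀ g₁ : Cube n → ℕ
    g₀ = g ∘ (false ∷_)
    g₁ = g ∘ (true ∷_)

  𝔼-scaled : ∀ n {k} .{{_ : NonZero k}} (f : Cube n → ℚ) (g : Cube n → ℕ) →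
    (∀ x → f x * natℚ k ≡ natℚ (g x)) → 𝔼 n f * natℚ (k ℕ.* 2 ℕ.^ n) ≡ natℚ (∑ n g)
  𝔼-scaled n {k} f g fk≡g = begin
    sumℚ (map f (allPts n)) * recip P * natℚ (k ℕ.* P)
      ≡⟨ cong₂ (λ s t → s * recip P * t) (sumℚ-allPts n f g f≡g/k) (natℚ-* k P) ⟩
    natℚ (∑ n g) * recip k * recip P * (natℚ k * natℚ P)
      ≡⟨ regroup (natℚ (∑ n g)) (recip k) (recip P) (natℚ k) (natℚ P) ⟩
    natℚ (∑ n g) * (recip k * natℚ k * (recip P * natℚ P))
      ≡⟨ cong₂ (λ s t → natℚ (∑ n g) * (s * t)) (recip*natℚ≡1 k) (recip*natℚ≡1 P) ⟩
    natℚ (∑ n g) * (1ℚ * 1ℚ)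
      ≡⟨ ℚ.*-identityʳ (natℚ (∑ n g)) ⟩
    natℚ (∑ n g)
      ∎
    where
    open ≡-Reasoning
    open +-*-Solver
    P : ℕ
    P = 2 ℕ.^ n
    instance
      2^n≢0 : NonZero P
      2^n≢0 = ℕ.m^n≢0 2 n
    regroup : ∀ a b c d e → a * b * c * (d * e) ≡ a * (b * d * (c * e))
    regroup = solve 5 (λ a b c d e → a :* b :* c :* (d :* e) := a :* (b :* d :* (c :* e))) refl
    f≡g/k : ∀ x → f x ≡ natℚ (g x) * recip k
    f≡g/k x = begin
      f x                          ≡⟨ ℚ.*-identityʳ (f x) ⟨
      f x * 1ℚ                     ≡⟨ cong (f x *_) (trans (ℚ.*-comm (natℚ k) (recip k)) (recip*natℚ≡1 k)) ⟨
      f x * (natℚ k * recip k)     ≡⟨ ℚ.*-assoc (f x) (natℚ k) (recip k) ⟨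
      f x * natℚ k * recip k       ≡⟨ cong (_* recip k) (fk≡g x) ⟩
      natℚ (g x) * recip k         ∎

  if*if : ∀ a b (t : ℚ) → (if a then t else 0ℚ) * (if b then t else 0ℚ) ≡ natℚ (𝟙 (a ∧ b)) * (t * t)
  if*if true  true  t = sym (ℚ.*-identityˡ (t * t))
  if*if true  false t = trans (ℚ.*-zeroʳ t) (sym (ℚ.*-zeroˡ (t * t)))
  if*if false b     t = trans (ℚ.*-zeroˡ (if b then t else 0ℚ)) (sym (ℚ.*-zeroˡ (t * t)))

  τ⁻¹*natℚ[C] : ∀ n → τ⁻¹ n * natℚ (n C (n ℕ./ 2)) ≡ natℚ (2 ℕ.^ n)
  τ⁻¹*natℚ[C] n = begin
    natℚ (2 ℕ.^ n) * recip c * natℚ c   ≡⟨ ℚ.*-assoc (natℚ (2 ℕ.^ n)) (recip c) (natℚ c) ⟩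
    natℚ (2 ℕ.^ n) * (recip c * natℚ c) ≡⟨ cong (natℚ (2 ℕ.^ n) *_) (recip*natℚ≡1 c) ⟩
    natℚ (2 ℕ.^ n) * 1ℚ                 ≡⟨ ℚ.*-identityʳ (natℚ (2 ℕ.^ n)) ⟩
    natℚ (2 ℕ.^ n)                      ∎
    where
    open ≡-Reasoning
    c : ℕ
    c = n C (n ℕ./ 2)
    instance
      c≢0 : NonZero c
      c≢0 = nCk≢0 (m/n≤m n 2)

  TT-scaled : ∀ n m (x : Cube n) → n ℕ./ 2 ≡ m →
    TT n x * natℚ ((n C m) ℕ.* (n C m)) ≡ natℚ (slicePairs m x ℕ.* 2 ℕ.^ n)
  TT-scaled n .(n ℕ./ 2) x refl = begin
    sumℚ (map (λ y → T n y * T n (x ⊕ y)) (allPts n)) * recip P * natℚ (c ℕ.* c)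
      ≡⟨ cong (λ s → s * recip P * natℚ (c ℕ.* c)) (sumℚ-allPts n _ _ T*T≡𝟙*τ⁻¹²) ⟩
    natℚ S * (τ⁻¹ n * τ⁻¹ n) * recip P * natℚ (c ℕ.* c)
      ≡⟨ regroupˡ (natℚ S) (τ⁻¹ n * τ⁻¹ n) (recip P) (natℚ (c ℕ.* c)) ⟩
    natℚ S * (τ⁻¹ n * τ⁻¹ n * natℚ (c ℕ.* c)) * recip P
      ≡⟨ cong (λ t → natℚ S * t * recip P) τ⁻¹²*natℚ[c²]≡natℚ[P]² ⟩
    natℚ S * (natℚ P * natℚ P) * recip P
      ≡⟨ regroupʳ (natℚ S) (natℚ P) (recip P) ⟩
    natℚ S * natℚ P * (recip P * natℚ P)
      ≡⟨ cong₂ _*_ (sym (natℚ-* S P)) (recip*natℚ≡1 P) ⟩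
    natℚ (S ℕ.* P) * 1ℚ
      ≡⟨ ℚ.*-identityʳ (natℚ (S ℕ.* P)) ⟩
    natℚ (S ℕ.* P)
      ∎
    where
    open ≡-Reasoning
    open +-*-Solver
    c P S : ℕ
    c = n C (n ℕ./ 2)
    P = 2 ℕ.^ n
    S = slicePairs (n ℕ./ 2) x
    instance
      2^n≢0 : NonZero P
      2^n≢0 = ℕ.m^n≢0 2 n
    T*T≡𝟙*τ⁻¹² : ∀ y → T n y * T n (x ⊕ y)
                    ≡ natℚ (𝟙 ((weight y ℕ.≡ᵇ n ℕ./ 2) ∧ (weight (x ⊕ y) ℕ.≡ᵇ n ℕ./ 2))) * (τ⁻¹ n * τ⁻¹ n)
    T*T≡𝟙*τ⁻¹² y = if*if (weight y ℕ.≡ᵇ n ℕ./ 2) (weight (x ⊕ y) ℕ.≡ᵇ n ℕ./ 2) (τ⁻¹ n)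
    τ⁻¹²*natℚ[c²]≡natℚ[P]² : τ⁻¹ n * τ⁻¹ n * natℚ (c ℕ.* c) ≡ natℚ P * natℚ P
    τ⁻¹²*natℚ[c²]≡natℚ[P]² =
      trans (*-scaled {τ⁻¹ n} {τ⁻¹ n} {c} {c} {P} {P} (τ⁻¹*natℚ[C] n) (τ⁻¹*natℚ[C] n)) (natℚ-* P P)
    regroupˡ : ∀ a t r k → a * t * r * k ≡ a * (t * k) * r
    regroupˡ = solve 4 (λ a t r k → a :* t :* r :* k := a :* (t :* k) :* r) refl
    regroupʳ : ∀ a p r → a * (p * p) * r ≡ a * p * (r * p)
    regroupʳ = solve 3 (λ a p r → a :* (p :* p) :* r := a :* p :* (r :* p)) refl

  TT-middle-< : ∀ q (x : Cube (q ℕ.* 2)) →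
    q ℕ.* 2 ℕ.≤ 3 ℕ.* weight x → 3 ℕ.* weight x ℕ.≤ 2 ℕ.* (q ℕ.* 2) → TT (q ℕ.* 2) x < natℚ 4
  TT-middle-< q x lo hi = <-of-scaled {k = centralBinomial q ℕ.* centralBinomial q} {m = 4}
    (TT-scaled (q ℕ.* 2) q x (m*n/n≡m q 2)) (slicePairs-middle-< q x lo hi)

  normSq-TT²-≤ : ∀ q → normSq (q ℕ.* 2) (λ x → TT (q ℕ.* 2) x * TT (q ℕ.* 2) x) ≤ natℚ 1024
  normSq-TT²-≤ q = ≤-of-scaled {k = K⁴ ℕ.* 2 ℕ.^ (q ℕ.* 2)} {m = 1024}
    (𝔼-scaled (q ℕ.* 2) {K⁴} _ _ λ x →
      fourth-power {TT (q ℕ.* 2) x} {K} {slicePairs q x ℕ.* 2 ℕ.^ (q ℕ.* 2)} (TT-scaled (q ℕ.* 2) q x (m*n/n≡m q 2)))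
    (∑-slicePairs⁴-bound q)
    where
    fourth-power : ∀ {p k a} → p * natℚ k ≡ natℚ a →
      p * p * (p * p) * natℚ (k ℕ.* k ℕ.* (k ℕ.* k)) ≡ natℚ (a ℕ.* a ℕ.* (a ℕ.* a))
    fourth-power {p} {k} {a} pk≡a =
      *-scaled {p * p} {p * p} {k ℕ.* k} {k ℕ.* k} {a ℕ.* a} {a ℕ.* a} p²k²≡a² p²k²≡a²
      where
      p²k²≡a² : p * p * natℚ (k ℕ.* k) ≡ natℚ (a ℕ.* a)
      p²k²≡a² = *-scaled {p} {p} {k} {k} {a} {a} pk≡a pk≡a
    B K K⁴ : ℕ
    B = centralBinomial q
    K = B ℕ.* B
    K⁴ = K ℕ.* K ℕ.* (K ℕ.* K)
    instance
      B≢0 : NonZero B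
      B≢0 = centralBinomial-nonZero q
      K≢0 : NonZero K
      K≢0 = ℕ.m*n≢0 B B
      K²≢0 : NonZero (K ℕ.* K)
      K²≢0 = ℕ.m*n≢0 K K
      K⁴≢0 : NonZero K⁴
      K⁴≢0 = ℕ.m*n≢0 (K ℕ.* K) (K ℕ.* K)
      K⁴*2^n≢0 : NonZero (K⁴ ℕ.* 2 ℕ.^ (q ℕ.* 2))
      K⁴*2^n≢0 = ℕ.m*n≢0 K⁴ (2 ℕ.^ (q ℕ.* 2)) {{K⁴≢0}} {{ℕ.m^n≢0 2 (q ℕ.* 2)}}

open import Defs
open import Data.Nat as ℕ using (ℕ)
open import Data.Nat.Divisibility using (_∣_; divides)
open import Data.Product using (_×_; ∃; _,_)
open import Data.Rational using (ℚ; _<_; _≤_; _*_)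
import Data.Rational.Properties as ℚ
open import Relation.Binary.PropositionalEquality using (refl)
open Rationals using (natℚ-*; TT-middle-<; normSq-TT²-≤)

claim3p3 : ((n : ℕ) → 2 ∣ n → (x : Cube n) →
                n ℕ.≤ 3 ℕ.* weight x → 3 ℕ.* weight x ℕ.≤ 2 ℕ.* n →
                TT n x < natℚ 4)
             × (∃ λ (C : ℚ) → (n : ℕ) → 2 ∣ n →
                  normSq n (λ x → TT n x * TT n x) ≤ C * C)
claim3p3 = middle-slice , natℚ 32 , bounded
  where
  middle-slice : (n : ℕ) → 2 ∣ n → (x : Cube n) →
    n ℕ.≤ 3 ℕ.* weight x → 3 ℕ.* weight x ℕ.≤ 2 ℕ.* n → TT n x < natℚ 4
  middle-slice .(q ℕ.* 2) (divides q refl) = TT-middle-< q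
  bounded : (n : ℕ) → 2 ∣ n → normSq n (λ x → TT n x * TT n x) ≤ natℚ 32 * natℚ 32
  bounded .(q ℕ.* 2) (divides q refl) = ℚ.≤-trans (normSq-TT²-≤ q) (ℚ.≤-reflexive (natℚ-* 32 32))
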